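{- For every integer $n\ge 2$, $g_n(12)=2\,g_{n-1}$.
   Context: Let $\mathcal S_n$ be the set of permutations of $\{1,\dots,n\}$. The standard cycle form of $\sigma\in\mathcal S_n$ writes $\sigma$ as a product of disjoint cycles (fixed points included as 1-cycles), each cycle written starting with its smallest letter, and the cycles arranged in increasing order of their smallest letters. $\mathrm{Flatten}(\sigma)$ is the permutation (word) of length $n$ obtained by erasing the parentheses in the standard cycle form of $\sigma$ (e.g. $71564328=(172)(3546)(8)$ gives $17235468$). An occurrence of the pattern 13-2 in a word $w_1w_2\cdots w_n$ is a pair of indices $(i,j)$ with $2\le i<j\le n$ and $w_{i-1}<w_j<w_i$. For a word $a_1\cdots a_k$, let $g_n(a_1a_2\cdots a_k)=\sum_{\pi} q^{\text{number of occurrences of 13-2 in }\mathrm{Flatten}(\pi)}$, the sum over all $\pi\in\mathcal S_n$ such that $\mathrm{Flatten}(\pi)$ starts with $a_1a_2\cdots a_k$; and $g_n=g_n(1)$ (the sum over all of $\mathcal S_n$). -}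

module Defs where

open import Data.Nat using (ℕ; zero; suc; _+_; _*_; _∸_; _≡ᵇ_; _<ᵇ_)
open import Data.Bool using (Bool; true; false; _∧_; if_then_else_; not)
open import Data.List using (List; []; _∷_; map; concatMap; filter; length; upTo)
open import Relation.Nullary.Decidable using (Dec; yes; no)
open import Data.Bool using (T)
open import Data.Bool.Properties using (T?)

-- A permutation of {1,…,n} is represented in one-line notation as a list
-- [σ(1), …, σ(n)].

letters : ℕ → List ℕ
letters n = map suc (upTo n)

words : ℕ → ℕ → List (List ℕ)
words n zero    = [] ∷ []
words n (suc k) = concatMap (λ a → map (a ∷_) (words n k)) (letters n)

elem : ℕ → List ℕ → Bool
elem a []       = false
elem a (b ∷ xs) = (a ≡ᵇ b) Data.Bool.∨ elem a xs

distinct : List ℕ → Bool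
distinct []       = true
distinct (x ∷ xs) = not (elem x xs) ∧ distinct xs

perms : ℕ → List (List ℕ)
perms n = filter (λ w → T? (distinct w)) (words n n)

-- σ(i) for the one-line word σ (1-indexed; 0 outside the range)
app : List ℕ → ℕ → ℕ
app []       _             = 0
app (x ∷ xs) 0             = 0
app (x ∷ xs) 1             = x
app (x ∷ xs) (suc (suc i)) = app xs (suc i)

-- the cycle of σ containing i, written starting from i:  i σ(i) σ²(i) …
-- (fuel bounds the cycle length; fuel = n is enough for σ ∈ S_n)
follow : List ℕ → ℕ → ℕ → ℕ → List ℕ
follow σ i zero       j = []
follow σ i (suc fuel) j = if j ≡ᵇ i then [] else j ∷ follow σ i fuel (app σ j)

cycleOf : List ℕ → ℕ → List ℕ
cycleOf σ i = i ∷ follow σ i (length σ) (app σ i)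

-- standard cycle form, with parentheses erased: scan i = 1,2,…,n; whenever
-- i is not yet in a previously written cycle, i is the smallest letter of
-- its cycle, and that cycle is written starting with i.
flattenFrom : List ℕ → List ℕ → List ℕ → List ℕ
flattenFrom σ visited []       = []
flattenFrom σ visited (i ∷ is) =
  if elem i visited
  then flattenFrom σ visited is
  else (let c = cycleOf σ i in c Data.List.++ flattenFrom σ (c Data.List.++ visited) is)

Flatten : List ℕ → List ℕ
Flatten σ = flattenFrom σ [] (letters (length σ))

-- number of occurrences of the pattern 13-2: pairs (i,j), 2 ≤ i < j ≤ n,
-- with w_{i-1} < w_j < w_i.
occ132 : List ℕ → ℕ
occ132 []            = 0
occ132 (a ∷ [])      = 0
occ132 (a ∷ b ∷ rest) =
  length (filter (λ c → T? ((a <ᵇ c) ∧ (c <ᵇ b))) rest) + occ132 (b ∷ rest)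

isPrefix : List ℕ → List ℕ → Bool
isPrefix []       _        = true
isPrefix (a ∷ as) []       = false
isPrefix (a ∷ as) (b ∷ bs) = (a ≡ᵇ b) ∧ isPrefix as bs

-- A polynomial in q with natural coefficients, given by its coefficient
-- function (coefficient of q^k).
Poly : Set
Poly = ℕ → ℕ

-- g_n(a_1…a_k) = Σ_{π ∈ S_n, Flatten(π) starts with a_1…a_k} q^{occ132(Flatten π)}
-- coefficient of q^k: number of such π with exactly k occurrences.
g-pre : ℕ → List ℕ → Poly
g-pre n pre k =
  length (filter (λ π → T? (isPrefix pre (Flatten π) ∧ (occ132 (Flatten π) ≡ᵇ k))) (perms n))

g : ℕ → Poly
g n = g-pre n (1 ∷ [])

_·_ : ℕ → Poly → Poly
(c · p) k = c * p k

-- Flatten π begins with 1 π(1), so it begins with 12 exactly when π(1) ∈ {1, 2}. Such a π comes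
-- from a unique σ ∈ S_(n-1) relabelled onto {2,…,n}: by adding 1 as a fixed point if π(1) = 1, and
-- by inserting 1 right before 2 in its cycle if π(1) = 2. Either way Flatten π = 1 (Flatten σ + 1),
-- and the new prefix 12 creates no occurrence of 13-2, so each family contributes g_(n-1).
module Submission where

open import Defs
open import Data.Nat using (ℕ; zero; suc; _+_; _*_; _∸_; _≤_; _<_; z≤n; s≤s; _≡ᵇ_; _<ᵇ_)
open import Data.Nat.Properties
  using (≡⇒≡ᵇ; ≡ᵇ⇒≡; n<1+n; m<n⇒m<1+n; ≤-reflexive; ≤-pred; +-comm; +-suc; m≤m*n; m+[n∸m]≡n; m≤n+m; ≤-trans; ≤-refl)
open import Data.Bool using (Bool; true; false; _∧_; _∨_; not; T)
open import Data.Bool.Properties using (∧-assoc; ∧-zeroʳ; ∨-assoc; T-∨; T-∧; T-not-≡)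
open import Function.Bundles using (Equivalence)
open import Data.List using (List; []; _∷_; map; concatMap; filterᵇ; length; upTo; _++_)
open import Data.Nat.ListAction using (sum)
open import Data.List.Properties using (map-cong; map-cong-local; length-++; length-map; map-++; map-∘; map-upTo; filter-++; filter-all; filter-none; ++-identityʳ)
open import Data.List.Membership.Propositional using (_∈_; _∉_)
open import Data.List.Membership.Propositional.Properties using (∈-++⁺ʳ)
open import Data.List.Relation.Binary.Subset.Propositional using (_⊆_)
open import Data.List.Relation.Unary.All as All using (All; []; _∷_)
open import Data.List.Relation.Unary.All.Properties using (map⁺; concat⁺)
open import Data.List.Relation.Unary.Any using (here; there)
open import Data.Product using (∃; _×_; _,_; proj₁; proj₂)
open import Data.Sum using (_⊎_; inj₁; inj₂; map₁)
open import Data.Empty using (⊥-elim)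
open import Data.Unit using (tt)
open import Data.Fin using (Fin; toℕ; fromℕ<)
open import Data.Fin.Properties using (pigeonhole; toℕ-fromℕ<; toℕ<n)
open import Function using (_∘_)
open import Relation.Nullary.Decidable using (T?)
open import Relation.Binary.PropositionalEquality
open ≡-Reasoning

count : {A : Set} → (A → Bool) → List A → ℕ
count p xs = length (filterᵇ p xs)

module _ {A : Set} where

  count-++ : (p : A → Bool) (xs ys : List A) → count p (xs ++ ys) ≡ count p xs + count p ys
  count-++ p xs ys = trans (cong length (filter-++ (T? ∘ p) xs ys)) (length-++ (filterᵇ p xs))

  count-cong : {p q : A → Bool} (xs : List A) → (∀ x → x ∈ xs → p x ≡ q x) → count p xs ≡ count q xs
  count-cong [] eq = refl
  count-cong {p} {q} (x ∷ xs) eq with p x | q x | eq x (here refl)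
  ... | true  | .true  | refl = cong suc (count-cong xs (λ y y∈xs → eq y (there y∈xs)))
  ... | false | .false | refl = count-cong xs (λ y y∈xs → eq y (there y∈xs))

  count-none : {p : A → Bool} (xs : List A) → (∀ x → x ∈ xs → p x ≡ false) → count p xs ≡ 0
  count-none [] _ = refl
  count-none {p} (x ∷ xs) none with p x | none x (here refl)
  ... | false | refl = count-none xs (λ y y∈xs → none y (there y∈xs))

  count-filterᵇ : (p q : A → Bool) (xs : List A) → count p (filterᵇ q xs) ≡ count (λ x → q x ∧ p x) xs
  count-filterᵇ p q [] = refl
  count-filterᵇ p q (x ∷ xs) with q x
  ... | false = count-filterᵇ p q xs
  ... | true with p x
  ...   | true  = cong suc (count-filterᵇ p q xs)
  ...   | false = count-filterᵇ p q xs

  count-map : {B : Set} (p : B → Bool) (f : A → B) (xs : List A) → count p (map f xs) ≡ count (p ∘ f) xs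
  count-map p f [] = refl
  count-map p f (x ∷ xs) with p (f x)
  ... | true  = cong suc (count-map p f xs)
  ... | false = count-map p f xs

  count-concatMap : (p : A → Bool) {B : Set} (h : B → List A) (bs : List B) →
                    count p (concatMap h bs) ≡ sum (map (count p ∘ h) bs)
  count-concatMap p h [] = refl
  count-concatMap p h (b ∷ bs) = trans (count-++ p (h b) (concatMap h bs)) (cong (count p (h b) +_) (count-concatMap p h bs))

sum-map-≡0 : {B : Set} (f : B → ℕ) {bs : List B} → All (λ b → f b ≡ 0) bs → sum (map f bs) ≡ 0
sum-map-≡0 f [] = refl
sum-map-≡0 f (fb≡0 ∷ rest) rewrite fb≡0 = sum-map-≡0 f rest

∈⇒elem : {a : ℕ} {xs : List ℕ} → a ∈ xs → T (elem a xs)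
∈⇒elem {a} (here refl) = Equivalence.from T-∨ (inj₁ (≡⇒≡ᵇ a a refl))
∈⇒elem (there a∈xs)    = Equivalence.from T-∨ (inj₂ (∈⇒elem a∈xs))

elem≡false⇒∉ : {a : ℕ} {xs : List ℕ} → elem a xs ≡ false → a ∉ xs
elem≡false⇒∉ eq a∈xs = subst T eq (∈⇒elem a∈xs)

elem-++ : (a : ℕ) (xs ys : List ℕ) → elem a (xs ++ ys) ≡ elem a xs ∨ elem a ys
elem-++ a [] ys = refl
elem-++ a (x ∷ xs) ys = trans (cong ((a ≡ᵇ x) ∨_) (elem-++ a xs ys)) (sym (∨-assoc (a ≡ᵇ x) (elem a xs) (elem a ys)))

module _ {f : ℕ → ℕ} (f-≡ᵇ : ∀ a b → (f a ≡ᵇ f b) ≡ (a ≡ᵇ b)) where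

  elem-map : (a : ℕ) (xs : List ℕ) → elem (f a) (map f xs) ≡ elem a xs
  elem-map a [] = refl
  elem-map a (x ∷ xs) = cong₂ _∨_ (f-≡ᵇ a x) (elem-map a xs)

  distinct-map : (xs : List ℕ) → distinct (map f xs) ≡ distinct xs
  distinct-map [] = refl
  distinct-map (x ∷ xs) = cong₂ (λ b c → not b ∧ c) (elem-map x xs) (distinct-map xs)

IsLetter : ℕ → ℕ → Set
IsLetter n x = 1 ≤ x × x ≤ n

letters-suc : (n : ℕ) → letters (suc n) ≡ 1 ∷ map suc (letters n)
letters-suc n = cong (λ l → 1 ∷ map suc l) (sym (map-upTo suc n))

letters-IsLetter : (n : ℕ) → All (IsLetter n) (letters n)
letters-IsLetter zero = []
letters-IsLetter (suc n) rewrite letters-suc n =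
  (s≤s z≤n , s≤s z≤n) ∷ map⁺ (All.map (λ (_ , x≤n) → s≤s z≤n , s≤s x≤n) (letters-IsLetter n))

words-IsLetter : (n k : ℕ) → All (λ w → length w ≡ k × All (IsLetter n) w) (words n k)
words-IsLetter n zero = (refl , []) ∷ []
words-IsLetter n (suc k) = concat⁺ (map⁺ (All.map extend (letters-IsLetter n)))
  where
    extend : ∀ {a} → IsLetter n a → All (λ w → length w ≡ suc k × All (IsLetter n) w) (map (a ∷_) (words n k))
    extend a-letter = map⁺ (All.map (λ (len , w-letters) → cong suc len , a-letter ∷ w-letters) (words-IsLetter n k))

filterᵇ-map : {A B : Set} (p : B → Bool) (f : A → B) (xs : List A) → filterᵇ p (map f xs) ≡ map f (filterᵇ (p ∘ f) xs)
filterᵇ-map p f [] = refl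
filterᵇ-map p f (x ∷ xs) with p (f x)
... | true  = cong (f x ∷_) (filterᵇ-map p f xs)
... | false = filterᵇ-map p f xs

prependEach : List (List ℕ) → ℕ → List (List ℕ)
prependEach W b = map (b ∷_) W

map-concatMap-prependEach : (e : ℕ → ℕ) (W : List (List ℕ)) (L : List ℕ) →
  map (map e) (concatMap (prependEach W) L) ≡ concatMap (prependEach (map (map e) W)) (map e L)
map-concatMap-prependEach e W [] = refl
map-concatMap-prependEach e W (b ∷ L) =
  trans (map-++ (map e) (map (b ∷_) W) _)
        (cong₂ _++_ (trans (sym (map-∘ W)) (map-∘ W)) (map-concatMap-prependEach e W L))

module _ (a : ℕ) where

  filter-avoiding-concatMap : (W : List (List ℕ)) (L : List ℕ) →
    filterᵇ (not ∘ elem a) (concatMap (prependEach W) L)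
      ≡ concatMap (prependEach (filterᵇ (not ∘ elem a) W)) (filterᵇ (not ∘ (a ≡ᵇ_)) L)
  filter-avoiding-concatMap W [] = refl
  filter-avoiding-concatMap W (b ∷ L) =
    trans (filter-++ (T? ∘ (not ∘ elem a)) (map (b ∷_) W) (concatMap (prependEach W) L))
          (trans (cong (_++ _) (filterᵇ-map (not ∘ elem a) (b ∷_) W)) split)
    where
      split : map (b ∷_) (filterᵇ (λ w → not ((a ≡ᵇ b) ∨ elem a w)) W) ++ filterᵇ (not ∘ elem a) (concatMap (prependEach W) L)
              ≡ concatMap (prependEach (filterᵇ (not ∘ elem a) W)) (filterᵇ (not ∘ (a ≡ᵇ_)) (b ∷ L))
      split with a ≡ᵇ b
      ... | true  = cong₂ (λ xs ys → map (b ∷_) xs ++ ys) (filter-none (T? ∘ λ _ → false) (All.universal (λ _ ()) W))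
                                                               (filter-avoiding-concatMap W L)
      ... | false = cong (map (b ∷_) (filterᵇ (not ∘ elem a) W) ++_) (filter-avoiding-concatMap W L)

  words-avoiding : {n m : ℕ} {e : ℕ → ℕ} → filterᵇ (not ∘ (a ≡ᵇ_)) (letters n) ≡ map e (letters m) →
                   (k : ℕ) → filterᵇ (not ∘ elem a) (words n k) ≡ map (map e) (words m k)
  words-avoiding letters-avoiding zero = refl
  words-avoiding {n} {m} {e} letters-avoiding (suc k) = begin
    filterᵇ (not ∘ elem a) (concatMap (prependEach (words n k)) (letters n))
      ≡⟨ filter-avoiding-concatMap (words n k) (letters n) ⟩
    concatMap (prependEach (filterᵇ (not ∘ elem a) (words n k))) (filterᵇ (not ∘ (a ≡ᵇ_)) (letters n))
      ≡⟨ cong₂ (λ W L → concatMap (prependEach W) L) (words-avoiding letters-avoiding k) letters-avoiding ⟩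
    concatMap (prependEach (map (map e) (words m k))) (map e (letters m))
      ≡⟨ map-concatMap-prependEach e (words m k) (letters m) ⟨
    map (map e) (words m (suc k)) ∎

  count-first-letter : {n m : ℕ} {e : ℕ → ℕ} → (∀ x y → (e x ≡ᵇ e y) ≡ (x ≡ᵇ y)) →
    filterᵇ (not ∘ (a ≡ᵇ_)) (letters n) ≡ map e (letters m) → (p : List ℕ → Bool) (k : ℕ) →
    count (λ w → distinct (a ∷ w) ∧ p (a ∷ w)) (words n k) ≡ count (λ σ → distinct σ ∧ p (a ∷ map e σ)) (words m k)
  count-first-letter {n} {m} {e} e-≡ᵇ letters-avoiding p k = begin
    count (λ w → (not (elem a w) ∧ distinct w) ∧ p (a ∷ w)) (words n k)
      ≡⟨ count-cong (words n k) (λ w _ → ∧-assoc (not (elem a w)) (distinct w) (p (a ∷ w))) ⟩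
    count (λ w → not (elem a w) ∧ (distinct w ∧ p (a ∷ w))) (words n k)
      ≡⟨ count-filterᵇ (λ w → distinct w ∧ p (a ∷ w)) (not ∘ elem a) (words n k) ⟨
    count (λ w → distinct w ∧ p (a ∷ w)) (filterᵇ (not ∘ elem a) (words n k))
      ≡⟨ cong (count (λ w → distinct w ∧ p (a ∷ w))) (words-avoiding letters-avoiding k) ⟩
    count (λ w → distinct w ∧ p (a ∷ w)) (map (map e) (words m k))
      ≡⟨ count-map (λ w → distinct w ∧ p (a ∷ w)) (map e) (words m k) ⟩
    count (λ σ → distinct (map e σ) ∧ p (a ∷ map e σ)) (words m k)
      ≡⟨ count-cong (words m k) (λ σ _ → cong (_∧ p (a ∷ map e σ)) (distinct-map e-≡ᵇ σ)) ⟩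
    count (λ σ → distinct σ ∧ p (a ∷ map e σ)) (words m k) ∎

iter : List ℕ → ℕ → ℕ → ℕ
iter σ zero    x = x
iter σ (suc t) x = iter σ t (app σ x)

iter-+ : (σ : List ℕ) (a b x : ℕ) → iter σ (a + b) x ≡ iter σ b (iter σ a x)
iter-+ σ zero    b x = refl
iter-+ σ (suc a) b x = iter-+ σ a b (app σ x)

iter-suc : (σ : List ℕ) (t x : ℕ) → iter σ (suc t) x ≡ app σ (iter σ t x)
iter-suc σ zero    x = refl
iter-suc σ (suc t) x = iter-suc σ t (app σ x)

iter-periodic : (σ : List ℕ) {p x : ℕ} → iter σ p x ≡ x → (q : ℕ) → iter σ (q * p) x ≡ x
iter-periodic σ period zero = refl
iter-periodic σ {p} {x} period (suc q) =
  trans (iter-+ σ p (q * p) x) (trans (cong (iter σ (q * p)) period) (iter-periodic σ period q))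

app-∈ : (σ : List ℕ) {x : ℕ} → IsLetter (length σ) x → app σ x ∈ σ
app-∈ (a ∷ σ) {suc zero}    _              = here refl
app-∈ (a ∷ σ) {suc (suc x)} (_ , s≤s x≤n) = there (app-∈ σ (s≤s z≤n , x≤n))

app-map : (f : ℕ → ℕ) (σ : List ℕ) {x : ℕ} → IsLetter (length σ) x → app (map f σ) x ≡ f (app σ x)
app-map f (a ∷ σ) {suc zero}    _              = refl
app-map f (a ∷ σ) {suc (suc x)} (_ , s≤s x≤n) = app-map f σ (s≤s z≤n , x≤n)

distinct-∷⁻ : {a : ℕ} {σ : List ℕ} → T (distinct (a ∷ σ)) → a ∉ σ × T (distinct σ)
distinct-∷⁻ {a} {σ} d with Equivalence.to T-∧ d
... | a-new , σ-distinct = elem≡false⇒∉ (Equivalence.to T-not-≡ a-new) , σ-distinct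

app-injective : (σ : List ℕ) → T (distinct σ) → {x y : ℕ} →
                IsLetter (length σ) x → IsLetter (length σ) y → app σ x ≡ app σ y → x ≡ y
app-injective (a ∷ σ) d {suc zero}    {suc zero}    _ _ _ = refl
app-injective (a ∷ σ) d {suc zero}    {suc (suc y)} _ (_ , s≤s y≤n) a≡σy =
  ⊥-elim (proj₁ (distinct-∷⁻ {a} {σ} d) (subst (_∈ σ) (sym a≡σy) (app-∈ σ (s≤s z≤n , y≤n))))
app-injective (a ∷ σ) d {suc (suc x)} {suc zero}    (_ , s≤s x≤n) _ σx≡a =
  ⊥-elim (proj₁ (distinct-∷⁻ {a} {σ} d) (subst (_∈ σ) σx≡a (app-∈ σ (s≤s z≤n , x≤n))))
app-injective (a ∷ σ) d {suc (suc x)} {suc (suc y)} (_ , s≤s x≤n) (_ , s≤s y≤n) σx≡σy =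
  cong suc (app-injective σ (proj₂ (distinct-∷⁻ {a} {σ} d)) (s≤s z≤n , x≤n) (s≤s z≤n , y≤n) σx≡σy)

module _ (σ : List ℕ) where

  follow-∌ : (i F j : ℕ) → i ∉ follow σ i F j
  follow-∌ i (suc F) j i∈ with j ≡ᵇ i in j≢i
  follow-∌ i (suc F) j () | true
  ... | false with i∈
  ...   | here i≡j = subst T j≢i (≡⇒≡ᵇ j i (sym i≡j))
  ...   | there i∈′ = follow-∌ i F (app σ j) i∈′

  follow-iter : {i y : ℕ} (F j : ℕ) → y ∈ follow σ i F j → ∃ λ a → iter σ a j ≡ y
  follow-iter {i} (suc F) j y∈ with j ≡ᵇ i
  follow-iter (suc F) j () | true
  ... | false with y∈
  ...   | here y≡j = 0 , sym y≡j
  ...   | there y∈′ with follow-iter F (app σ j) y∈′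
  ...     | a , σᵃ⁺¹j≡y = suc a , σᵃ⁺¹j≡y

  cycleOf-iter : {x y : ℕ} → y ∈ cycleOf σ x → ∃ λ a → iter σ a x ≡ y
  cycleOf-iter (here y≡x) = 0 , sym y≡x
  cycleOf-iter {x} (there y∈) with follow-iter (length σ) (app σ x) y∈
  ... | a , σᵃ⁺¹x≡y = suc a , σᵃ⁺¹x≡y

  follow-fuel : {i t F F′ : ℕ} (j : ℕ) → iter σ t j ≡ i → t < F → t < F′ → follow σ i F j ≡ follow σ i F′ j
  follow-fuel {i} {t} {suc F} {suc F′} j σᵗj≡i (s≤s t<F) (s≤s t<F′) with j ≡ᵇ i in j≟i
  ... | true = refl
  ... | false with t
  ...   | zero  = ⊥-elim (subst T j≟i (≡⇒≡ᵇ j i σᵗj≡i))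
  ...   | suc t = cong (j ∷_) (follow-fuel (app σ j) σᵗj≡i t<F t<F′)

  follow-start : {i F : ℕ} (j : ℕ) → 0 < F → j ∈ follow σ i F j ⊎ j ≡ i
  follow-start {i} {suc F} j _ with j ≡ᵇ i in j≟i
  ... | true  = inj₂ (≡ᵇ⇒≡ j i (subst T (sym j≟i) tt))
  ... | false = inj₁ (here refl)

  follow-closed : {i t F y : ℕ} (j : ℕ) → iter σ t j ≡ i → t < F → y ∈ follow σ i F j →
                  app σ y ∈ follow σ i F j ⊎ app σ y ≡ i
  follow-closed {i} {t} {suc F} j σᵗj≡i (s≤s t<F) y∈ with j ≡ᵇ i in j≟i
  follow-closed j σᵗj≡i (s≤s t<F) () | true
  ... | false with t | t<F | y∈
  ...   | zero  | _ | _ = ⊥-elim (subst T j≟i (≡⇒≡ᵇ j i σᵗj≡i))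
  ...   | suc t | t<F′ | there y∈′ = map₁ there (follow-closed (app σ j) σᵗj≡i t<F′ y∈′)
  ...   | suc t | t<F′ | here refl = map₁ there (follow-start (app σ j) (≤-trans (s≤s z≤n) t<F′))

  cycleOf-closed : {i t y : ℕ} → iter σ t (app σ i) ≡ i → t < length σ → y ∈ cycleOf σ i → app σ y ∈ cycleOf σ i
  cycleOf-closed {i} period t<m (here refl) with follow-start (app σ i) (≤-trans (s≤s z≤n) t<m)
  ... | inj₁ σi∈ = there σi∈
  ... | inj₂ σi≡i = here σi≡i
  cycleOf-closed {i} period t<m (there y∈) with follow-closed (app σ i) period t<m y∈
  ... | inj₁ σy∈ = there σy∈
  ... | inj₂ σy≡i = here σy≡i

follow-map : (σ π : List ℕ) (h : ℕ → ℕ) {i : ℕ} → (∀ y → (h y ≡ᵇ h i) ≡ (y ≡ᵇ i)) → (F j : ℕ) →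
             (∀ y → y ∈ follow σ i F j → app π (h y) ≡ h (app σ y)) →
             follow π (h i) F (h j) ≡ map h (follow σ i F j)
follow-map σ π h h-≡ᵇ zero j _ = refl
follow-map σ π h {i} h-≡ᵇ (suc F) j intertwines rewrite h-≡ᵇ j with j ≡ᵇ i
... | true  = refl
... | false = cong (h j ∷_) (trans (cong (follow π (h i) F) (intertwines j (here refl)))
                                   (follow-map σ π h h-≡ᵇ F (app σ j) (λ y y∈ → intertwines y (there y∈))))

-- In cycle notation, extend₁ σ is σ + 1 with the fixed point 1 added, and extend₂ σ is σ + 1
-- with 1 inserted right before 2.
extend₁ : List ℕ → List ℕ
extend₁ σ = 1 ∷ map suc σ

skip2 : ℕ → ℕ
skip2 zero          = zero
skip2 (suc zero)    = 1
skip2 (suc (suc x)) = suc (suc (suc x))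

extend₂ : List ℕ → List ℕ
extend₂ σ = 2 ∷ map skip2 σ

skip2-≡ᵇ : (x y : ℕ) → (skip2 x ≡ᵇ skip2 y) ≡ (x ≡ᵇ y)
skip2-≡ᵇ zero          zero          = refl
skip2-≡ᵇ zero          (suc zero)    = refl
skip2-≡ᵇ zero          (suc (suc y)) = refl
skip2-≡ᵇ (suc zero)    zero          = refl
skip2-≡ᵇ (suc zero)    (suc zero)    = refl
skip2-≡ᵇ (suc zero)    (suc (suc y)) = refl
skip2-≡ᵇ (suc (suc x)) zero          = refl
skip2-≡ᵇ (suc (suc x)) (suc zero)    = refl
skip2-≡ᵇ (suc (suc x)) (suc (suc y)) = refl

skip2-suc : {x : ℕ} → 1 ≤ x → x ≢ 1 → skip2 x ≡ suc x
skip2-suc {x = suc zero}    _ x≢1 = ⊥-elim (x≢1 refl)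
skip2-suc {x = suc (suc x)} _ _   = refl

app-extend₁ : (σ : List ℕ) {y : ℕ} → IsLetter (length σ) y → app (extend₁ σ) (suc y) ≡ suc (app σ y)
app-extend₁ σ {suc y} y-letter = app-map suc σ y-letter

app-extend₂ : (σ : List ℕ) {y : ℕ} → IsLetter (length σ) y → app (extend₂ σ) (suc y) ≡ skip2 (app σ y)
app-extend₂ σ {suc y} y-letter = app-map skip2 σ y-letter

Mirrors : List ℕ → List ℕ → Set
Mirrors Vπ V = ∀ x → 1 ≤ x → elem (suc x) Vπ ≡ elem x V

mirrors-start : (V : List ℕ) → Mirrors (1 ∷ map suc V) V
mirrors-start V (suc x) _ = elem-map (λ _ _ → refl) (suc x) V

mirrors-++ : {Vπ V : List ℕ} → Mirrors Vπ V → (c : List ℕ) → Mirrors (map suc c ++ Vπ) (c ++ V)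
mirrors-++ {Vπ} {V} mirror c x 1≤x = begin
  elem (suc x) (map suc c ++ Vπ)            ≡⟨ elem-++ (suc x) (map suc c) Vπ ⟩
  elem (suc x) (map suc c) ∨ elem (suc x) Vπ ≡⟨ cong₂ _∨_ (elem-map (λ _ _ → refl) x c) (mirror x 1≤x) ⟩
  elem x c ∨ elem x V                       ≡⟨ elem-++ x c V ⟨
  elem x (c ++ V)                           ∎

-- E holds the letters whose cycles are not transported by suc; they must already be visited.
module _ (σ π E : List ℕ)
         (cycleOf-shift : ∀ {i} → IsLetter (length σ) i → i ∉ E → cycleOf π (suc i) ≡ map suc (cycleOf σ i)) where

  flattenFrom-shift : {V Vπ : List ℕ} (L : List ℕ) → All (IsLetter (length σ)) L → E ⊆ V → Mirrors Vπ V →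
                      flattenFrom π Vπ (map suc L) ≡ map suc (flattenFrom σ V L)
  flattenFrom-shift [] _ _ _ = refl
  flattenFrom-shift {V} {Vπ} (i ∷ L) (i-letter ∷ L-letters) E⊆V mirror
    rewrite mirror i (proj₁ i-letter) with elem i V in i-visited
  ... | true  = flattenFrom-shift L L-letters E⊆V mirror
  ... | false = begin
    cycleOf π (suc i) ++ flattenFrom π (cycleOf π (suc i) ++ Vπ) (map suc L)
      ≡⟨ cong (λ c → c ++ flattenFrom π (c ++ Vπ) (map suc L)) shift ⟩
    map suc c ++ flattenFrom π (map suc c ++ Vπ) (map suc L)
      ≡⟨ cong (map suc c ++_) (flattenFrom-shift L L-letters (∈-++⁺ʳ c ∘ E⊆V) (mirrors-++ mirror c)) ⟩
    map suc c ++ map suc (flattenFrom σ (c ++ V) L)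
      ≡⟨ map-++ suc c _ ⟨
    map suc (c ++ flattenFrom σ (c ++ V) L) ∎
    where
      c = cycleOf σ i
      shift = cycleOf-shift i-letter (λ i∈E → elem≡false⇒∉ i-visited (E⊆V i∈E))

Flatten-∷ : (a : ℕ) (σ : List ℕ) →
  Flatten (a ∷ σ) ≡ cycleOf (a ∷ σ) 1 ++ flattenFrom (a ∷ σ) (cycleOf (a ∷ σ) 1) (map suc (letters (length σ)))
Flatten-∷ a σ = trans (cong (flattenFrom (a ∷ σ) []) (letters-suc (length σ)))
                      (cong (λ V → C ++ flattenFrom (a ∷ σ) V (map suc (letters (length σ)))) (++-identityʳ C))
  where C = cycleOf (a ∷ σ) 1

Flatten-unfold : (σ : List ℕ) → 1 ≤ length σ →
  Flatten σ ≡ cycleOf σ 1 ++ flattenFrom σ (cycleOf σ 1) (letters (length σ))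
Flatten-unfold (a ∷ σ) _ =
  trans (Flatten-∷ a σ) (cong (λ L → cycleOf (a ∷ σ) 1 ++ flattenFrom (a ∷ σ) (cycleOf (a ∷ σ) 1) L) (sym (letters-suc (length σ))))

module Permutation (σ : List ℕ) (σ-letters : All (IsLetter (length σ)) σ) (σ-distinct : T (distinct σ)) where

  private
    n : ℕ
    n = length σ

  app-IsLetter : {x : ℕ} → IsLetter n x → IsLetter n (app σ x)
  app-IsLetter x-letter = All.lookup σ-letters (app-∈ σ x-letter)

  iter-IsLetter : {x : ℕ} (t : ℕ) → IsLetter n x → IsLetter n (iter σ t x)
  iter-IsLetter zero    x-letter = x-letter
  iter-IsLetter (suc t) x-letter = iter-IsLetter t (app-IsLetter x-letter)

  follow-IsLetter : {i F j y : ℕ} → IsLetter n j → y ∈ follow σ i F j → IsLetter n y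
  follow-IsLetter {F = F} {j} j-letter y∈ with follow-iter σ F j y∈
  ... | a , σᵃj≡y = subst (IsLetter n) σᵃj≡y (iter-IsLetter a j-letter)

  iter-injective : {x y : ℕ} (t : ℕ) → IsLetter n x → IsLetter n y → iter σ t x ≡ iter σ t y → x ≡ y
  iter-injective zero    _        _        eq = eq
  iter-injective (suc t) x-letter y-letter eq =
    app-injective σ σ-distinct x-letter y-letter
      (iter-injective t (app-IsLetter x-letter) (app-IsLetter y-letter) eq)

  letterIndex : {x : ℕ} → IsLetter n x → Fin n
  letterIndex {suc x} (_ , x<n) = fromℕ< x<n

  letterIndex-injective : {x y : ℕ} (x-letter : IsLetter n x) (y-letter : IsLetter n y) →
                          letterIndex x-letter ≡ letterIndex y-letter → x ≡ y
  letterIndex-injective {suc x} {suc y} (_ , x<n) (_ , y<n) eq =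
    cong suc (trans (sym (toℕ-fromℕ< x<n)) (trans (cong toℕ eq) (toℕ-fromℕ< y<n)))

  -- Pigeonhole on the iterates σ⁰x, …, σⁿx gives σᵃx = σᵇx with a < b, and σ is injective.
  orbit-returns : {x : ℕ} → IsLetter n x → ∃ λ t → t < n × iter σ (suc t) x ≡ x
  orbit-returns {x} x-letter
    with pigeonhole (n<1+n n) (λ a → letterIndex (iter-IsLetter (toℕ a) x-letter))
  ... | a , b , a<b , same-index = t , t<n , iter-injective (toℕ a) (iter-IsLetter (suc t) x-letter) x-letter σᵃ⁺ᵗ⁺¹x≡σᵃx
    where
      A B t : ℕ
      A = toℕ a
      B = toℕ b
      t = B ∸ suc A
      1+a+t≡b : suc A + t ≡ B
      1+a+t≡b = m+[n∸m]≡n a<b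
      A+1+t≡B : A + suc t ≡ B
      A+1+t≡B = trans (+-suc A t) 1+a+t≡b
      t<n : t < n
      t<n = ≤-trans (s≤s (m≤n+m t A)) (≤-trans (≤-reflexive 1+a+t≡b) (≤-pred (toℕ<n b)))
      σᵃ⁺ᵗ⁺¹x≡σᵃx : iter σ A (iter σ (suc t) x) ≡ iter σ A x
      σᵃ⁺ᵗ⁺¹x≡σᵃx = begin
        iter σ A (iter σ (suc t) x) ≡⟨ iter-+ σ (suc t) A x ⟨
        iter σ (suc t + A) x        ≡⟨ cong (λ s → iter σ s x) (trans (+-comm (suc t) A) A+1+t≡B) ⟩
        iter σ B x                  ≡⟨ letterIndex-injective (iter-IsLetter A x-letter) (iter-IsLetter B x-letter) same-index ⟨
        iter σ A x                  ∎

  iter∈cycleOf : {i : ℕ} → IsLetter n i → (c : ℕ) → iter σ c i ∈ cycleOf σ i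
  iter∈cycleOf i-letter zero = here refl
  iter∈cycleOf {i} i-letter (suc c) with orbit-returns i-letter
  ... | t , t<n , period =
    subst (_∈ cycleOf σ i) (sym (iter-suc σ c i)) (cycleOf-closed σ period t<n (iter∈cycleOf i-letter c))

  cycleOf-sym : {x y : ℕ} → IsLetter n x → y ∈ cycleOf σ x → x ∈ cycleOf σ y
  cycleOf-sym {x} {y} x-letter y∈ with cycleOf-iter σ y∈ | orbit-returns x-letter
  ... | a , σᵃx≡y | t , _ , period = subst (_∈ cycleOf σ y) σᵈy≡x (iter∈cycleOf y-letter d)
    where
      d : ℕ
      d = a * suc t ∸ a
      y-letter : IsLetter n y
      y-letter = subst (IsLetter n) σᵃx≡y (iter-IsLetter a x-letter)
      σᵈy≡x : iter σ d y ≡ x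
      σᵈy≡x = begin
        iter σ d y            ≡⟨ cong (iter σ d) σᵃx≡y ⟨
        iter σ d (iter σ a x) ≡⟨ iter-+ σ a d x ⟨
        iter σ (a + d) x      ≡⟨ cong (λ s → iter σ s x) (m+[n∸m]≡n (m≤m*n a (suc t))) ⟩
        iter σ (a * suc t) x  ≡⟨ iter-periodic σ period a ⟩
        x                     ∎

  cycleOf-fuel : {i : ℕ} → IsLetter n i → follow σ i (suc n) (app σ i) ≡ follow σ i n (app σ i)
  cycleOf-fuel i-letter with orbit-returns i-letter
  ... | t , t<n , period = follow-fuel σ _ period (m<n⇒m<1+n t<n) t<n

  cycleOf-extend₁ : {i : ℕ} → IsLetter n i → cycleOf (extend₁ σ) (suc i) ≡ map suc (cycleOf σ i)
  cycleOf-extend₁ {i} i-letter = cong (suc i ∷_) (begin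
    follow π (suc i) (suc (length (map suc σ))) (app π (suc i))
      ≡⟨ cong₂ (λ l j → follow π (suc i) (suc l) j) (length-map suc σ) (app-extend₁ σ i-letter) ⟩
    follow π (suc i) (suc n) (suc (app σ i))
      ≡⟨ follow-map σ π suc (λ _ → refl) (suc n) (app σ i) intertwines ⟩
    map suc (follow σ i (suc n) (app σ i))
      ≡⟨ cong (map suc) (cycleOf-fuel i-letter) ⟩
    map suc (follow σ i n (app σ i)) ∎)
    where
      π = extend₁ σ
      intertwines : ∀ y → y ∈ follow σ i (suc n) (app σ i) → app π (suc y) ≡ suc (app σ y)
      intertwines y y∈ = app-extend₁ σ (follow-IsLetter {F = suc n} (app-IsLetter i-letter) y∈)

  -- Outside the cycle of 1, σ never maps to 1, so extend₂ σ acts there as σ shifted by one.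
  cycleOf-extend₂ : {i : ℕ} → IsLetter n i → i ∉ cycleOf σ 1 → cycleOf (extend₂ σ) (suc i) ≡ map suc (cycleOf σ i)
  cycleOf-extend₂ {i} i-letter i∉ = cong (suc i ∷_) (begin
    follow π (suc i) (suc (length (map skip2 σ))) (app π (suc i))
      ≡⟨ cong₂ (λ l j → follow π (suc i) (suc l) j) (length-map skip2 σ) (app-extend₂ σ i-letter) ⟩
    follow π (suc i) (suc n) (skip2 (app σ i))
      ≡⟨ cong (follow π (suc i) (suc n)) (skip2-suc (proj₁ (app-IsLetter i-letter)) (σσⁱ≢1 0)) ⟩
    follow π (suc i) (suc n) (suc (app σ i))
      ≡⟨ follow-map σ π suc (λ _ → refl) (suc n) (app σ i) intertwines ⟩
    map suc (follow σ i (suc n) (app σ i))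
      ≡⟨ cong (map suc) (cycleOf-fuel i-letter) ⟩
    map suc (follow σ i n (app σ i)) ∎)
    where
      π = extend₂ σ
      σσⁱ≢1 : ∀ a → app σ (iter σ a i) ≢ 1
      σσⁱ≢1 a σᵃ⁺¹i≡1 =
        i∉ (cycleOf-sym i-letter (subst (_∈ cycleOf σ i) (trans (iter-suc σ a i) σᵃ⁺¹i≡1) (iter∈cycleOf i-letter (suc a))))
      σy≢1 : ∀ y → y ∈ follow σ i (suc n) (app σ i) → app σ y ≢ 1
      σy≢1 y y∈ with follow-iter σ (suc n) (app σ i) y∈
      ... | a , σᵃ⁺¹i≡y = subst (λ z → app σ z ≢ 1) σᵃ⁺¹i≡y (σσⁱ≢1 (suc a))
      intertwines : ∀ y → y ∈ follow σ i (suc n) (app σ i) → app π (suc y) ≡ suc (app σ y)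
      intertwines y y∈ = trans (app-extend₂ σ y-letter) (skip2-suc (proj₁ (app-IsLetter y-letter)) (σy≢1 y y∈))
        where y-letter = follow-IsLetter {F = suc n} (app-IsLetter i-letter) y∈

  cycleOf-extend₂-1 : 1 ≤ n → cycleOf (extend₂ σ) 1 ≡ 1 ∷ map suc (cycleOf σ 1)
  cycleOf-extend₂-1 1≤n = cong (λ c → 1 ∷ 2 ∷ c) (begin
    follow π 1 (length (map skip2 σ)) (app (map skip2 σ) 1)
      ≡⟨ cong₂ (follow π 1) (length-map skip2 σ) (app-map skip2 σ one) ⟩
    follow π 1 n (skip2 (app σ 1))
      ≡⟨ follow-map σ π skip2 (λ y → skip2-≡ᵇ y 1) n (app σ 1) intertwines ⟩
    map skip2 (follow σ 1 n (app σ 1))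
      ≡⟨ map-cong-local (All.tabulate (λ y∈ → skip2-suc (proj₁ (y-letter y∈)) (y≢1 y∈))) ⟩
    map suc (follow σ 1 n (app σ 1)) ∎)
    where
      π = extend₂ σ
      one : IsLetter n 1
      one = ≤-refl , 1≤n
      y-letter : ∀ {y} → y ∈ follow σ 1 n (app σ 1) → IsLetter n y
      y-letter = follow-IsLetter {F = n} (app-IsLetter one)
      y≢1 : ∀ {y} → y ∈ follow σ 1 n (app σ 1) → y ≢ 1
      y≢1 y∈ refl = follow-∌ σ 1 n (app σ 1) y∈
      intertwines : ∀ y → y ∈ follow σ 1 n (app σ 1) → app π (skip2 y) ≡ skip2 (app σ y)
      intertwines y y∈ = trans (cong (app π) (skip2-suc (proj₁ (y-letter y∈)) (y≢1 y∈))) (app-extend₂ σ (y-letter y∈))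

  Flatten-extend₁ : Flatten (extend₁ σ) ≡ 1 ∷ map suc (Flatten σ)
  Flatten-extend₁ = begin
    Flatten π
      ≡⟨ Flatten-∷ 1 (map suc σ) ⟩
    1 ∷ flattenFrom π (1 ∷ []) (map suc (letters (length (map suc σ))))
      ≡⟨ cong (λ l → 1 ∷ flattenFrom π (1 ∷ []) (map suc (letters l))) (length-map suc σ) ⟩
    1 ∷ flattenFrom π (1 ∷ []) (map suc (letters n))
      ≡⟨ cong (1 ∷_) (flattenFrom-shift σ π [] (λ i-letter _ → cycleOf-extend₁ i-letter)
                        (letters n) (letters-IsLetter n) (λ ()) (mirrors-start [])) ⟩
    1 ∷ map suc (Flatten σ) ∎
    where π = extend₁ σ

  Flatten-extend₂ : 1 ≤ n → Flatten (extend₂ σ) ≡ 1 ∷ map suc (Flatten σ)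
  Flatten-extend₂ 1≤n = begin
    Flatten π
      ≡⟨ Flatten-∷ 2 (map skip2 σ) ⟩
    cycleOf π 1 ++ flattenFrom π (cycleOf π 1) (map suc (letters (length (map skip2 σ))))
      ≡⟨ cong₂ (λ c l → c ++ flattenFrom π c (map suc (letters l))) (cycleOf-extend₂-1 1≤n) (length-map skip2 σ) ⟩
    1 ∷ map suc C ++ flattenFrom π (1 ∷ map suc C) (map suc (letters n))
      ≡⟨ cong (λ w → 1 ∷ map suc C ++ w) (flattenFrom-shift σ π C cycleOf-extend₂
                                             (letters n) (letters-IsLetter n) (λ x∈ → x∈) (mirrors-start C)) ⟩
    1 ∷ map suc C ++ map suc (flattenFrom σ C (letters n))
      ≡⟨ cong (1 ∷_) (map-++ suc C _) ⟨
    1 ∷ map suc (C ++ flattenFrom σ C (letters n))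
      ≡⟨ cong (λ w → 1 ∷ map suc w) (Flatten-unfold σ 1≤n) ⟨
    1 ∷ map suc (Flatten σ) ∎
    where
      π = extend₂ σ
      C = cycleOf σ 1

occ132-map-suc : (w : List ℕ) → occ132 (map suc w) ≡ occ132 w
occ132-map-suc []            = refl
occ132-map-suc (a ∷ [])      = refl
occ132-map-suc (a ∷ b ∷ rest) =
  cong₂ _+_ (count-map (λ c → (suc a <ᵇ c) ∧ (c <ᵇ suc b)) suc rest) (occ132-map-suc (b ∷ rest))

occ132-12 : (r : List ℕ) → occ132 (1 ∷ 2 ∷ map suc r) ≡ occ132 (1 ∷ r)
occ132-12 r = cong₂ _+_ no-occurrence-at-2 (occ132-map-suc (1 ∷ r))
  where
    no-occurrence-at-2 : count (λ c → (1 <ᵇ c) ∧ (c <ᵇ 2)) (map suc r) ≡ 0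
    no-occurrence-at-2 = trans (count-map (λ c → (1 <ᵇ c) ∧ (c <ᵇ 2)) suc r)
                               (count-none r λ { zero _ → refl ; (suc c) _ → refl })

startsWith : List ℕ → ℕ → List ℕ → Bool
startsWith pre k w = isPrefix pre w ∧ (occ132 w ≡ᵇ k)

Starts : List ℕ → ℕ → List ℕ → Bool
Starts pre k π = startsWith pre k (Flatten π)

Starts-12-shift : (k : ℕ) (σ π : List ℕ) → 1 ≤ length σ → Flatten π ≡ 1 ∷ map suc (Flatten σ) →
                  Starts (1 ∷ 2 ∷ []) k π ≡ Starts (1 ∷ []) k σ
Starts-12-shift k (a ∷ σ) π _ Flatten-π = begin
  startsWith (1 ∷ 2 ∷ []) k (Flatten π)                    ≡⟨ cong (startsWith (1 ∷ 2 ∷ []) k) Flatten-π ⟩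
  startsWith (1 ∷ 2 ∷ []) k (1 ∷ map suc (Flatten (a ∷ σ))) ≡⟨ cong (λ w → startsWith (1 ∷ 2 ∷ []) k (1 ∷ map suc w)) Flatten-σ ⟩
  startsWith (1 ∷ 2 ∷ []) k (1 ∷ 2 ∷ map suc r)            ≡⟨ cong (_≡ᵇ k) (occ132-12 r) ⟩
  startsWith (1 ∷ []) k (1 ∷ r)                            ≡⟨ cong (startsWith (1 ∷ []) k) Flatten-σ ⟨
  startsWith (1 ∷ []) k (Flatten (a ∷ σ))                  ∎
  where
    r : List ℕ
    r = _
    Flatten-σ : Flatten (a ∷ σ) ≡ 1 ∷ r
    Flatten-σ = Flatten-∷ a σ

g-pre-count : (n : ℕ) (pre : List ℕ) (k : ℕ) → g-pre n pre k ≡ count (λ w → distinct w ∧ Starts pre k w) (words n n)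
g-pre-count n pre k = count-filterᵇ (Starts pre k) distinct (words n n)

letters-suc² : (m : ℕ) → letters (suc (suc m)) ≡ 1 ∷ 2 ∷ map suc (map suc (letters m))
letters-suc² m = trans (letters-suc (suc m)) (cong (λ l → 1 ∷ map suc l) (letters-suc m))

letters-avoiding-1 : (m : ℕ) → filterᵇ (not ∘ (1 ≡ᵇ_)) (letters (suc m)) ≡ map suc (letters m)
letters-avoiding-1 m = trans (cong (filterᵇ (not ∘ (1 ≡ᵇ_))) (letters-suc m))
                             (filter-all (T? ∘ (not ∘ (1 ≡ᵇ_))) (map⁺ (map⁺ (All.universal (λ _ → tt) (upTo m)))))

letters-avoiding-2 : (m : ℕ) → filterᵇ (not ∘ (2 ≡ᵇ_)) (letters (suc (suc m))) ≡ map skip2 (letters (suc m))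
letters-avoiding-2 m = begin
  filterᵇ (not ∘ (2 ≡ᵇ_)) (letters (suc (suc m)))     ≡⟨ cong (filterᵇ (not ∘ (2 ≡ᵇ_))) (letters-suc² m) ⟩
  1 ∷ filterᵇ (not ∘ (2 ≡ᵇ_)) (map suc from2) ≡⟨ cong (1 ∷_) (filter-all (T? ∘ (not ∘ (2 ≡ᵇ_))) above-2) ⟩
  1 ∷ map suc from2                            ≡⟨ cong (1 ∷_) (map-cong-local skip2-is-suc) ⟨
  1 ∷ map skip2 from2                          ≡⟨ cong (map skip2) (letters-suc m) ⟨
  map skip2 (letters (suc m))                  ∎
  where
    from2 : List ℕ
    from2 = map suc (letters m)
    above-2 : All (T ∘ not ∘ (2 ≡ᵇ_)) (map suc from2)
    above-2 = map⁺ (map⁺ (map⁺ (All.universal (λ _ → tt) (upTo m))))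
    skip2-is-suc : All (λ x → skip2 x ≡ suc x) from2
    skip2-is-suc = map⁺ (map⁺ (All.universal (λ _ → refl) (upTo m)))

count-first-extended : {a m : ℕ} {e : ℕ → ℕ} → 1 ≤ m → (∀ x y → (e x ≡ᵇ e y) ≡ (x ≡ᵇ y)) →
  filterᵇ (not ∘ (a ≡ᵇ_)) (letters (suc m)) ≡ map e (letters m) →
  (∀ σ → All (IsLetter (length σ)) σ → T (distinct σ) → 1 ≤ length σ → Flatten (a ∷ map e σ) ≡ 1 ∷ map suc (Flatten σ)) →
  (k : ℕ) → count (λ w → distinct (a ∷ w) ∧ Starts (1 ∷ 2 ∷ []) k (a ∷ w)) (words (suc m) m) ≡ g m k
count-first-extended {a} {m} {e} 1≤m e-≡ᵇ letters-avoiding Flatten-extend k = begin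
  count (λ w → distinct (a ∷ w) ∧ Starts (1 ∷ 2 ∷ []) k (a ∷ w)) (words (suc m) m)
    ≡⟨ count-first-letter a e-≡ᵇ letters-avoiding (Starts (1 ∷ 2 ∷ []) k) m ⟩
  count (λ σ → distinct σ ∧ Starts (1 ∷ 2 ∷ []) k (a ∷ map e σ)) (words m m)
    ≡⟨ count-cong (words m m) same-on-permutations ⟩
  count (λ σ → distinct σ ∧ Starts (1 ∷ []) k σ) (words m m)
    ≡⟨ g-pre-count m (1 ∷ []) k ⟨
  g m k ∎
  where
    same-on-permutations : ∀ σ → σ ∈ words m m →
      distinct σ ∧ Starts (1 ∷ 2 ∷ []) k (a ∷ map e σ) ≡ distinct σ ∧ Starts (1 ∷ []) k σ
    same-on-permutations σ σ∈ with distinct σ in σ-distinct | All.lookup (words-IsLetter m m) σ∈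
    ... | false | _ = refl
    ... | true  | length≡m , σ-letters =
      Starts-12-shift k σ (a ∷ map e σ) 1≤length
        (Flatten-extend σ (subst (λ l → All (IsLetter l) σ) (sym length≡m) σ-letters) (subst T (sym σ-distinct) tt) 1≤length)
      where 1≤length = subst (1 ≤_) (sym length≡m) 1≤m

count-by-first-letter : (p : List ℕ → Bool) (n k : ℕ) →
  count p (words n (suc k)) ≡ sum (map (λ a → count (λ w → p (a ∷ w)) (words n k)) (letters n))
count-by-first-letter p n k =
  trans (count-concatMap p (prependEach (words n k)) (letters n))
        (cong sum (map-cong (λ a → count-map p (a ∷_) (words n k)) (letters n)))

-- The standard cycle form starts with the cycle of 1, so Flatten π begins 1 π(1).
Starts-12-≥3 : (k u b : ℕ) (w : List ℕ) → Starts (1 ∷ 2 ∷ []) k (suc (suc (suc u)) ∷ b ∷ w) ≡ false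
Starts-12-≥3 k u b w = refl

count-first-≥3 : (n k j u : ℕ) →
  count (λ w → distinct (suc (suc (suc u)) ∷ w) ∧ Starts (1 ∷ 2 ∷ []) j (suc (suc (suc u)) ∷ w)) (words n (suc k)) ≡ 0
count-first-≥3 n k j u = count-none (words n (suc k)) rejected
  where
    a = suc (suc (suc u))
    rejected : ∀ w → w ∈ words n (suc k) → distinct (a ∷ w) ∧ Starts (1 ∷ 2 ∷ []) j (a ∷ w) ≡ false
    rejected (b ∷ w) _ = trans (cong (distinct (a ∷ b ∷ w) ∧_) (Starts-12-≥3 j u b w)) (∧-zeroʳ (distinct (a ∷ b ∷ w)))
    rejected [] w∈ with proj₁ (All.lookup (words-IsLetter n (suc k)) w∈)
    ... | ()

lemma2p1 : (n : ℕ) → 2 ≤ n → (k : ℕ) →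
    g-pre n (1 ∷ 2 ∷ []) k ≡ (2 · g (n ∸ 1)) k
lemma2p1 (suc (suc m)) (s≤s (s≤s z≤n)) k = begin
  g-pre N (1 ∷ 2 ∷ []) k                        ≡⟨ g-pre-count N (1 ∷ 2 ∷ []) k ⟩
  count D (words N N)                           ≡⟨ count-by-first-letter D N (suc m) ⟩
  sum (map byFirst (letters N))                 ≡⟨ cong (sum ∘ map byFirst) (letters-suc² m) ⟩
  byFirst 1 + (byFirst 2 + sum (map byFirst (map suc (map suc (letters m)))))
                                                ≡⟨ cong₂ _+_ first-1 (cong₂ _+_ first-2 first-≥3) ⟩
  g (suc m) k + (g (suc m) k + 0)               ∎
  where
    N = suc (suc m)
    D : List ℕ → Bool
    D w = distinct w ∧ Starts (1 ∷ 2 ∷ []) k w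
    byFirst : ℕ → ℕ
    byFirst a = count (λ w → D (a ∷ w)) (words N (suc m))
    first-1 : byFirst 1 ≡ g (suc m) k
    first-1 = count-first-extended (s≤s z≤n) (λ _ _ → refl) (letters-avoiding-1 (suc m))
                (λ σ σ-letters σ-distinct _ → Permutation.Flatten-extend₁ σ σ-letters σ-distinct) k
    first-2 : byFirst 2 ≡ g (suc m) k
    first-2 = count-first-extended (s≤s z≤n) skip2-≡ᵇ (letters-avoiding-2 m) Permutation.Flatten-extend₂ k
    first-≥3 : sum (map byFirst (map suc (map suc (letters m)))) ≡ 0
    first-≥3 = sum-map-≡0 byFirst (map⁺ (map⁺ (map⁺ (All.universal (count-first-≥3 N m k) (upTo m)))))
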